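{- Let $N,M\ge0$ be integers and $Q=abcd$. With all sums over $(m_1,m_2,m_3,m_4)\in\mathbb{N}^4$ with $m_1+m_2+m_3+m_4=N$ and $\begin{bmatrix}\cdot\\ \cdot\end{bmatrix}=\begin{bmatrix}\cdot\\ \cdot\end{bmatrix}_Q$: $$\sum_{\pi\in\mathcal{S}^2_{2N,2M+1}}\omega^2_\pi=\sum\begin{bmatrix}M+1\\ m_1\end{bmatrix}a^{m_1}Q^{\binom{m_1}{2}}\begin{bmatrix}M+m_2\\ m_2\end{bmatrix}(ab)^{m_2}\begin{bmatrix}M\\ m_3\end{bmatrix}(abc)^{m_3}Q^{\binom{m_3}{2}}\begin{bmatrix}M+m_4\\ m_4\end{bmatrix},$$ $$\sum_{\pi\in\mathcal{S}^2_{2N+1,2M+1}}\omega^2_\pi=\sum\begin{bmatrix}M\\ m_1\end{bmatrix}(1+a)a^{m_1}Q^{\binom{m_1+1}{2}}\begin{bmatrix}M+m_2\\ m_2\end{bmatrix}(ab)^{m_2}\begin{bmatrix}M\\ m_3\end{bmatrix}(abc)^{m_3}Q^{\binom{m_3}{2}}\begin{bmatrix}M+m_4\\ m_4\end{bmatrix},$$ $$\sum_{\pi\in\mathcal{S}^2_{2N,2M}}\omega^2_\pi=\sum\begin{bmatrix}M\\ m_1\end{bmatrix}a^{m_1}Q^{\binom{m_1}{2}}\begin{bmatrix}M+m_2-1\\ m_2\end{bmatrix}(ab)^{m_2}\begin{bmatrix}M\\ m_3\end{bmatrix}(abc)^{m_3}Q^{\binom{m_3}{2}}\begin{bmatrix}M+m_4\\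 m_4\end{bmatrix},$$ $$\sum_{\pi\in\mathcal{S}^2_{2N+1,2M}}\omega^2_\pi=\sum\begin{bmatrix}M-1\\ m_1\end{bmatrix}(1+a)a^{m_1}Q^{\binom{m_1+1}{2}}\begin{bmatrix}M+m_2-1\\ m_2\end{bmatrix}(ab)^{m_2}\begin{bmatrix}M\\ m_3\end{bmatrix}(abc)^{m_3}Q^{\binom{m_3}{2}}\begin{bmatrix}M+m_4\\ m_4\end{bmatrix},$$ where $\omega^2_\pi=\omega^2_\pi(a,b,c,d)$.
   Context: $\mathcal{S}^2_{N',M'}$ is the set of partitions whose odd parts are all distinct, with largest part $\le N'$ and at most $M'$ parts (empty partition included). The weight $\omega^2_\pi(a,b,c,d)$ is the product of labels when cells of each odd-indexed row of the Ferrers diagram (top row indexed 1) are labelled left to right alternately $a,b,\dots$ and cells of each even-indexed row alternately $c,d,\dots$. $\begin{bmatrix}n\\ k\end{bmatrix}_q=\frac{(q;q)_n}{(q;q)_k(q;q)_{n-k}}$ for $n\ge k\ge0$ and $0$ otherwise, $(q;q)_n=\prod_{i=1}^n(1-q^i)$. -}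

module Defs where

open import Level using (Level)
open import Data.Nat as ℕ using (ℕ; zero; suc; _≟_; _≥_; _≥?_; _∸_; _%_)
open import Data.Nat.Combinatorics using (_C_)
open import Data.Product using (_×_; _,_)
open import Data.List using (List; []; _∷_; map; filter; concatMap; upTo; foldr)
open import Data.List.Relation.Unary.Linked using (Linked; linked?)
open import Data.List.Relation.Unary.Unique.DecPropositional _≟_ using (Unique; unique?)
open import Relation.Binary.PropositionalEquality using (_≡_)
open import Relation.Nullary using (Dec; _×-dec_)
open import Algebra.Bundles using (CommutativeRing)

-- A partition with at most M' parts and largest part ≤ N' is encoded as a
-- weakly decreasing list of exactly M' naturals, each in {0,…,N'}
-- (trailing zeros = absent parts).  This is a bijection with such
-- partitions (the empty partition is the all-zero list).

boundedLists : (m n : ℕ) → List (List ℕ)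
boundedLists zero    n = [] ∷ []
boundedLists (suc m) n =
  concatMap (λ x → map (x ∷_) (boundedLists m n)) (upTo (suc n))

IsOdd : ℕ → Set
IsOdd n = n % 2 ≡ 1

isOdd? : (n : ℕ) → Dec (IsOdd n)
isOdd? n = (n % 2) ≟ 1

oddParts : List ℕ → List ℕ
oddParts = filter isOdd?

IsS2 : List ℕ → Set
IsS2 λs = Linked _≥_ λs × Unique (oddParts λs)

isS2? : (λs : List ℕ) → Dec (IsS2 λs)
isS2? λs = linked? _≥?_ λs ×-dec unique? (oddParts λs)

S2 : (N′ M′ : ℕ) → List (List ℕ)
S2 N′ M′ = filter isS2? (boundedLists M′ N′)

binom2 : ℕ → ℕ
binom2 m = m C 2

compositions4 : ℕ → List (ℕ × ℕ × ℕ × ℕ)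
compositions4 N =
  filter (λ { (m₁ , m₂ , m₃ , m₄) → (m₁ ℕ.+ m₂ ℕ.+ m₃ ℕ.+ m₄) ≟ N })
    (concatMap (λ m₁ → concatMap (λ m₂ → concatMap (λ m₃ →
       map (λ m₄ → (m₁ , m₂ , m₃ , m₄)) (upTo (suc N)))
       (upTo (suc N))) (upTo (suc N))) (upTo (suc N)))

module _ {ℓ₁ ℓ₂ : Level} (R : CommutativeRing ℓ₁ ℓ₂) where
  open CommutativeRing R

  pow : Carrier → ℕ → Carrier
  pow x zero    = 1#
  pow x (suc n) = x * pow x n

  sumR : List Carrier → Carrier
  sumR = foldr _+_ 0#

  -- Gaussian binomial [n k]_q, defined by the q-Pascal recurrence
  --   [n+1, k+1] = [n, k] + q^(k+1) [n, k+1],  [n,0] = 1,  [0,k+1] = 0,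
  -- i.e. the polynomial (q;q)_n / ((q;q)_k (q;q)_{n-k}) for n ≥ k ≥ 0,
  -- and 0 for k > n.
  gauss : Carrier → ℕ → ℕ → Carrier
  gauss q n       zero    = 1#
  gauss q zero    (suc k) = 0#
  gauss q (suc n) (suc k) = gauss q n k + pow q (suc k) * gauss q n (suc k)

  rowWeight : Carrier → Carrier → ℕ → Carrier
  rowWeight x y zero    = 1#
  rowWeight x y (suc n) = x * rowWeight y x n

  -- ω²_π(a,b,c,d): odd-indexed rows (1st, 3rd, …) labelled a,b,a,…;
  -- even-indexed rows labelled c,d,c,…
  ω² : Carrier → Carrier → Carrier → Carrier → List ℕ → Carrier
  ω² a b c d []       = 1#
  ω² a b c d (l ∷ λs) = rowWeight a b l * ω² c d a b λs

  genS2 : Carrier → Carrier → Carrier → Carrier → ℕ → ℕ → Carrier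
  genS2 a b c d N′ M′ = sumR (map (ω² a b c d) (S2 N′ M′))

  sum4 : ℕ → (ℕ → ℕ → ℕ → ℕ → Carrier) → Carrier
  sum4 N f = sumR (map (λ { (m₁ , m₂ , m₃ , m₄) → f m₁ m₂ m₃ m₄ }) (compositions4 N))

module Submission where

-- Write F(N, K) for the sum of ω² over S²_{N,K}. Removing the first two columns of the
-- partitions with exactly K + 1 parts gives F(N+2, K+1) = F(N+2, K) + u F(N, K) + v F(N, K+1)
-- for monomials u, v in a, b, c, d depending on K. For N = 2n + p with p fixed, this says
-- that, as power series in t, Σₙ F(2n+p, K+1) tⁿ = (1 + u t) / (1 − v t) · Σₙ F(2n+p, K) tⁿ.
-- Each right-hand side is the coefficient of t^N in a product of four series, each of the form
-- ∏ (1 + x Qⁱ t) or ∏ (1 − x Qⁱ t)⁻¹ (q-binomial theorem), and raising K by one adds exactly one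
-- factor 1 + u t to a product of the first kind and one factor (1 − v t)⁻¹ to one of the second
-- kind. Since such a recurrence determines a sequence from its predecessor, induction on K
-- finishes the proof.

open import Defs
open import Level using (Level)
open import Data.Nat using (ℕ; suc; _≤_; _∸_)
open import Data.Nat using () renaming (_+_ to _+ℕ_; _*_ to _*ℕ_)
open import Data.Product using (_×_)
open import Algebra.Bundles using (CommutativeRing)

open import Data.Nat.Base using (zero; _<_; _≥_; z≤n; s≤s; _<ᵇ_; _≡ᵇ_; _≤ᵇ_)
open import Data.Nat.Properties using (_≤?_)
import Data.Nat.Properties as ℕₚ
open import Data.Bool.Base using (Bool; true; false; _∧_)
open import Data.List.Base using (List; []; _∷_; _++_; map; filter; concatMap; applyUpTo; upTo)
open import Data.Product.Base using (_,_; proj₁; proj₂)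
open import Function.Base using (_∘_)
open import Relation.Nullary.Decidable.Core using (Dec; does; yes; no)
open import Relation.Binary.PropositionalEquality.Core as ≡ using (_≡_; _≢_)

module FiniteSums {ℓ₁ ℓ₂} (R : CommutativeRing ℓ₁ ℓ₂) where
  open CommutativeRing R hiding (zero)
  open import Relation.Binary.Reasoning.Setoid setoid
  open import Algebra.Properties.CommutativeSemigroup +-commutativeSemigroup
    using () renaming (interchange to +-interchange)

  ∑< : ℕ → (ℕ → Carrier) → Carrier
  ∑< zero    f = 0#
  ∑< (suc n) f = f 0 + ∑< n (f ∘ suc)

  ∑<-cong : ∀ n {f g : ℕ → Carrier} → (∀ i → f i ≈ g i) → ∑< n f ≈ ∑< n g
  ∑<-cong zero    f≈g = refl
  ∑<-cong (suc n) f≈g = +-cong (f≈g 0) (∑<-cong n (f≈g ∘ suc))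

  ∑<-cong-< : ∀ n {f g : ℕ → Carrier} → (∀ i → i < n → f i ≈ g i) → ∑< n f ≈ ∑< n g
  ∑<-cong-< zero    f≈g = refl
  ∑<-cong-< (suc n) f≈g = +-cong (f≈g 0 (s≤s z≤n)) (∑<-cong-< n (λ i i<n → f≈g (suc i) (s≤s i<n)))

  ∑<-+ : ∀ n (f g : ℕ → Carrier) → ∑< n (λ i → f i + g i) ≈ ∑< n f + ∑< n g
  ∑<-+ zero    f g = sym (+-identityˡ 0#)
  ∑<-+ (suc n) f g = trans (+-congˡ (∑<-+ n (f ∘ suc) (g ∘ suc))) (+-interchange (f 0) (g 0) _ _)

  ∑<-*ˡ : ∀ n c (f : ℕ → Carrier) → ∑< n (λ i → c * f i) ≈ c * ∑< n f
  ∑<-*ˡ zero    c f = sym (zeroʳ c)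
  ∑<-*ˡ (suc n) c f = trans (+-congˡ (∑<-*ˡ n c (f ∘ suc))) (sym (distribˡ c (f 0) _))

  ∑<-zero : ∀ n {f : ℕ → Carrier} → (∀ i → f i ≈ 0#) → ∑< n f ≈ 0#
  ∑<-zero zero    f≈0 = refl
  ∑<-zero (suc n) f≈0 = trans (+-cong (f≈0 0) (∑<-zero n (f≈0 ∘ suc))) (+-identityˡ 0#)

  ∑<-last : ∀ n (f : ℕ → Carrier) → ∑< (suc n) f ≈ ∑< n f + f n
  ∑<-last zero    f = trans (+-identityʳ (f 0)) (sym (+-identityˡ (f 0)))
  ∑<-last (suc n) f = trans (+-congˡ (∑<-last n (f ∘ suc))) (sym (+-assoc (f 0) _ _))

  infixr 8 [_]*_
  [_]*_ : Bool → Carrier → Carrier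
  [ true  ]* x = x
  [ false ]* x = 0#

  []*-cong : ∀ b {x y} → x ≈ y → [ b ]* x ≈ [ b ]* y
  []*-cong true  x≈y = x≈y
  []*-cong false x≈y = refl

  []*-*ˡ : ∀ b c x → [ b ]* (c * x) ≈ c * [ b ]* x
  []*-*ˡ true  c x = refl
  []*-*ˡ false c x = sym (zeroʳ c)

  -- Tests m ≤ n are written m <ᵇ suc n, which computes by recursion on both arguments.
  ∑<-truncate : ∀ B N → B ≤ N → (f : ℕ → Carrier) →
                ∑< (suc N) (λ i → [ i <ᵇ suc B ]* f i) ≈ ∑< (suc B) f
  ∑<-truncate zero    N       _         f = +-congˡ (∑<-zero N (λ _ → refl))
  ∑<-truncate (suc B) (suc N) (s≤s B≤N) f = +-congˡ (∑<-truncate B N B≤N (f ∘ suc))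

  -- The last index s + N ≥ N + 1 never passes the test.
  private
    +-<ᵇ-false : ∀ m n → (m +ℕ n <ᵇ n) ≡ false
    +-<ᵇ-false m zero    = ≡.refl
    +-<ᵇ-false m (suc n) rewrite ℕₚ.+-suc m n = +-<ᵇ-false m n

    +-≡ᵇ-false : ∀ m n → (m +ℕ suc n ≡ᵇ n) ≡ false
    +-≡ᵇ-false m zero    rewrite ℕₚ.+-suc m zero = ≡.refl
    +-≡ᵇ-false m (suc n) rewrite ℕₚ.+-suc m (suc n) = +-≡ᵇ-false m n

  ∑<-<ᵇ : ∀ N s (f : ℕ → Carrier) →
          ∑< (suc N) (λ m → [ s +ℕ m <ᵇ suc N ]* f m) ≈ [ s <ᵇ suc N ]* ∑< (suc (N ∸ s)) f
  ∑<-<ᵇ N       zero    f = ∑<-truncate N N ℕₚ.≤-refl f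
  ∑<-<ᵇ zero    (suc s) f = +-identityʳ 0#
  ∑<-<ᵇ (suc N) (suc s) f = begin
    ∑< (suc (suc N)) (λ m → [ s +ℕ m <ᵇ suc N ]* f m)
      ≈⟨ ∑<-last (suc N) (λ m → [ s +ℕ m <ᵇ suc N ]* f m) ⟩
    ∑< (suc N) (λ m → [ s +ℕ m <ᵇ suc N ]* f m) + [ s +ℕ suc N <ᵇ suc N ]* f (suc N)
      ≈⟨ +-cong (∑<-<ᵇ N s f) (≡.subst (λ b → [ b ]* f (suc N) ≈ 0#) (≡.sym (+-<ᵇ-false s (suc N))) refl) ⟩
    [ s <ᵇ suc N ]* ∑< (suc (N ∸ s)) f + 0#
      ≈⟨ +-identityʳ _ ⟩
    [ s <ᵇ suc N ]* ∑< (suc (N ∸ s)) f ∎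

  ∑<-≡ᵇ : ∀ N s (f : ℕ → Carrier) →
          ∑< (suc N) (λ m → [ s +ℕ m ≡ᵇ N ]* f m) ≈ [ s <ᵇ suc N ]* f (N ∸ s)
  ∑<-≡ᵇ zero    zero    f = +-identityʳ (f 0)
  ∑<-≡ᵇ (suc N) zero    f = trans (+-identityˡ _) (∑<-≡ᵇ N zero (f ∘ suc))
  ∑<-≡ᵇ zero    (suc s) f = +-identityʳ 0#
  ∑<-≡ᵇ (suc N) (suc s) f = begin
    ∑< (suc (suc N)) (λ m → [ s +ℕ m ≡ᵇ N ]* f m)
      ≈⟨ ∑<-last (suc N) (λ m → [ s +ℕ m ≡ᵇ N ]* f m) ⟩
    ∑< (suc N) (λ m → [ s +ℕ m ≡ᵇ N ]* f m) + [ s +ℕ suc N ≡ᵇ N ]* f (suc N)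
      ≈⟨ +-cong (∑<-≡ᵇ N s f) (≡.subst (λ b → [ b ]* f (suc N) ≈ 0#) (≡.sym (+-≡ᵇ-false s N)) refl) ⟩
    [ s <ᵇ suc N ]* f (N ∸ s) + 0#
      ≈⟨ +-identityʳ _ ⟩
    [ s <ᵇ suc N ]* f (N ∸ s) ∎

  ∑ᴸ : {A : Set} → (A → Carrier) → List A → Carrier
  ∑ᴸ f xs = sumR R (map f xs)

  module _ {A : Set} where
    ∑ᴸ-cong : ∀ {f g : A → Carrier} xs → (∀ x → f x ≈ g x) → ∑ᴸ f xs ≈ ∑ᴸ g xs
    ∑ᴸ-cong []       f≈g = refl
    ∑ᴸ-cong (x ∷ xs) f≈g = +-cong (f≈g x) (∑ᴸ-cong xs f≈g)

    ∑ᴸ-++ : ∀ (f : A → Carrier) xs ys → ∑ᴸ f (xs ++ ys) ≈ ∑ᴸ f xs + ∑ᴸ f ys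
    ∑ᴸ-++ f []       ys = sym (+-identityˡ _)
    ∑ᴸ-++ f (x ∷ xs) ys = trans (+-congˡ (∑ᴸ-++ f xs ys)) (sym (+-assoc (f x) _ _))

    ∑ᴸ-*ˡ : ∀ c (f : A → Carrier) xs → ∑ᴸ (λ x → c * f x) xs ≈ c * ∑ᴸ f xs
    ∑ᴸ-*ˡ c f []       = sym (zeroʳ c)
    ∑ᴸ-*ˡ c f (x ∷ xs) = trans (+-congˡ (∑ᴸ-*ˡ c f xs)) (sym (distribˡ c (f x) _))

    ∑ᴸ-[]* : ∀ b (f : A → Carrier) xs → ∑ᴸ (λ x → [ b ]* f x) xs ≈ [ b ]* ∑ᴸ f xs
    ∑ᴸ-[]* true  f xs       = refl
    ∑ᴸ-[]* false f []       = refl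
    ∑ᴸ-[]* false f (x ∷ xs) = trans (+-congˡ (∑ᴸ-[]* false f xs)) (+-identityˡ 0#)

    ∑ᴸ-filter : ∀ {p} {P : A → Set p} (P? : ∀ x → Dec (P x)) (f : A → Carrier) xs →
                ∑ᴸ f (filter P? xs) ≈ ∑ᴸ (λ x → [ does (P? x) ]* f x) xs
    ∑ᴸ-filter P? f [] = refl
    ∑ᴸ-filter P? f (x ∷ xs) with does (P? x)
    ... | true  = +-congˡ (∑ᴸ-filter P? f xs)
    ... | false = trans (∑ᴸ-filter P? f xs) (sym (+-identityˡ _))

    ∑ᴸ-applyUpTo : ∀ (f : A → Carrier) (h : ℕ → A) n → ∑ᴸ f (applyUpTo h n) ≈ ∑< n (f ∘ h)
    ∑ᴸ-applyUpTo f h zero    = refl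
    ∑ᴸ-applyUpTo f h (suc n) = +-congˡ (∑ᴸ-applyUpTo f (h ∘ suc) n)

  module _ {A B : Set} where
    ∑ᴸ-map : ∀ (f : B → Carrier) (h : A → B) xs → ∑ᴸ f (map h xs) ≈ ∑ᴸ (f ∘ h) xs
    ∑ᴸ-map f h []       = refl
    ∑ᴸ-map f h (x ∷ xs) = +-congˡ (∑ᴸ-map f h xs)

  module _ {B : Set} where
    ∑ᴸ-concatMap-upTo : ∀ (f : B → Carrier) (g : ℕ → List B) n →
                        ∑ᴸ f (concatMap g (upTo n)) ≈ ∑< n (λ i → ∑ᴸ f (g i))
    ∑ᴸ-concatMap-upTo f g n = trans (go (upTo n)) (∑ᴸ-applyUpTo (λ i → ∑ᴸ f (g i)) (λ i → i) n)
      where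
      go : ∀ xs → ∑ᴸ f (concatMap g xs) ≈ ∑ᴸ (λ i → ∑ᴸ f (g i)) xs
      go []       = refl
      go (x ∷ xs) = trans (∑ᴸ-++ f (g x) (concatMap g xs)) (+-congˡ (go xs))

    ∑ᴸ-map-upTo : ∀ (f : B → Carrier) (h : ℕ → B) n → ∑ᴸ f (map h (upTo n)) ≈ ∑< n (f ∘ h)
    ∑ᴸ-map-upTo f h n = trans (∑ᴸ-map f h (upTo n)) (∑ᴸ-applyUpTo (f ∘ h) (λ i → i) n)

module Sequences {ℓ₁ ℓ₂} (R : CommutativeRing ℓ₁ ℓ₂) where
  open CommutativeRing R hiding (zero)
  open FiniteSums R
  open import Relation.Binary.Reasoning.Setoid setoid

  Seq : Set ℓ₁
  Seq = ℕ → Carrier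

  infix  4 _≋_
  infixl 6 _⊕_
  infixr 7 _·t_ _⊛_

  _≋_ : Seq → Seq → Set ℓ₂
  X ≋ Y = ∀ n → X n ≈ Y n

  _⊕_ : Seq → Seq → Seq
  (X ⊕ Y) n = X n + Y n

  -- In generating-function terms u ·t X is u t X(t), and _⊛_ is the product.
  _·t_ : Carrier → Seq → Seq
  (u ·t X) zero    = 0#
  (u ·t X) (suc n) = u * X n

  _⊛_ : Seq → Seq → Seq
  (X ⊛ Y) n = ∑< (suc n) (λ i → X i * Y (n ∸ i))

  ⊕-cong : ∀ {X X′ Y Y′} → X ≋ X′ → Y ≋ Y′ → X ⊕ Y ≋ X′ ⊕ Y′
  ⊕-cong X≋X′ Y≋Y′ n = +-cong (X≋X′ n) (Y≋Y′ n)

  ·t-cong : ∀ {u u′ X X′} → u ≈ u′ → X ≋ X′ → u ·t X ≋ u′ ·t X′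
  ·t-cong u≈u′ X≋X′ zero    = refl
  ·t-cong u≈u′ X≋X′ (suc n) = *-cong u≈u′ (X≋X′ n)

  ⊛-cong : ∀ {X X′ Y Y′} → X ≋ X′ → Y ≋ Y′ → X ⊛ Y ≋ X′ ⊛ Y′
  ⊛-cong X≋X′ Y≋Y′ n = ∑<-cong (suc n) (λ i → *-cong (X≋X′ i) (Y≋Y′ (n ∸ i)))

  ⊛-distribʳ-⊕ : ∀ X X′ Y → (X ⊕ X′) ⊛ Y ≋ X ⊛ Y ⊕ X′ ⊛ Y
  ⊛-distribʳ-⊕ X X′ Y n =
    trans (∑<-cong (suc n) (λ i → distribʳ (Y (n ∸ i)) (X i) (X′ i)))
          (∑<-+ (suc n) (λ i → X i * Y (n ∸ i)) (λ i → X′ i * Y (n ∸ i)))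

  ⊛-distribˡ-⊕ : ∀ X Y Y′ → X ⊛ (Y ⊕ Y′) ≋ X ⊛ Y ⊕ X ⊛ Y′
  ⊛-distribˡ-⊕ X Y Y′ n =
    trans (∑<-cong (suc n) (λ i → distribˡ (X i) (Y (n ∸ i)) (Y′ (n ∸ i))))
          (∑<-+ (suc n) (λ i → X i * Y (n ∸ i)) (λ i → X i * Y′ (n ∸ i)))

  ·t-⊛ : ∀ u X Y → (u ·t X) ⊛ Y ≋ u ·t (X ⊛ Y)
  ·t-⊛ u X Y zero    = trans (+-identityʳ _) (zeroˡ (Y 0))
  ·t-⊛ u X Y (suc n) = begin
    0# * Y (suc n) + ∑< (suc n) (λ i → (u * X i) * Y (n ∸ i))
      ≈⟨ +-cong (zeroˡ (Y (suc n))) (∑<-cong (suc n) (λ i → *-assoc u (X i) (Y (n ∸ i)))) ⟩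
    0# + ∑< (suc n) (λ i → u * (X i * Y (n ∸ i)))
      ≈⟨ trans (+-identityˡ _) (∑<-*ˡ (suc n) u (λ i → X i * Y (n ∸ i))) ⟩
    u * (X ⊛ Y) n ∎

  ⊛-·t : ∀ u X Y → X ⊛ (u ·t Y) ≋ u ·t (X ⊛ Y)
  ⊛-·t u X Y zero    = trans (+-identityʳ _) (zeroʳ (X 0))
  ⊛-·t u X Y (suc n) = begin
    ∑< (suc (suc n)) (λ i → X i * (u ·t Y) (suc n ∸ i))
      ≈⟨ ∑<-last (suc n) (λ i → X i * (u ·t Y) (suc n ∸ i)) ⟩
    ∑< (suc n) (λ i → X i * (u ·t Y) (suc n ∸ i)) + X (suc n) * (u ·t Y) (n ∸ n)
      ≈⟨ +-cong (∑<-cong-< (suc n) inner)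
                (≡.subst (λ k → X (suc n) * (u ·t Y) k ≈ 0#) (≡.sym (ℕₚ.n∸n≡0 n)) (zeroʳ _)) ⟩
    ∑< (suc n) (λ i → u * (X i * Y (n ∸ i))) + 0#
      ≈⟨ trans (+-identityʳ _) (∑<-*ˡ (suc n) u (λ i → X i * Y (n ∸ i))) ⟩
    u * (X ⊛ Y) n ∎
    where
    inner : ∀ i → i < suc n → X i * (u ·t Y) (suc n ∸ i) ≈ u * (X i * Y (n ∸ i))
    inner i (s≤s i≤n) rewrite ℕₚ.+-∸-assoc 1 i≤n = x∙yz≈y∙xz (X i) u (Y (n ∸ i))
      where open import Algebra.Properties.CommutativeSemigroup *-commutativeSemigroup using (x∙yz≈y∙xz)

  ⊛-δˡ : ∀ X Y → (∀ i → X (suc i) ≈ 0#) → X ⊛ Y ≋ (λ n → X 0 * Y n)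
  ⊛-δˡ X Y X≈δ n =
    trans (+-congˡ (∑<-zero n (λ i → trans (*-congʳ (X≈δ i)) (zeroˡ _)))) (+-identityʳ _)

  ⊛-linearˡ : ∀ W P Q u → W ⊛ (P ⊕ u ·t Q) ≋ W ⊛ P ⊕ u ·t (W ⊛ Q)
  ⊛-linearˡ W P Q u n = trans (⊛-distribˡ-⊕ W P (u ·t Q) n) (+-congˡ (⊛-·t u W Q n))

  ⊛-linearʳ : ∀ W P Q u → (P ⊕ u ·t Q) ⊛ W ≋ P ⊛ W ⊕ u ·t (Q ⊛ W)
  ⊛-linearʳ W P Q u n = trans (⊛-distribʳ-⊕ P (u ·t Q) W n) (+-congˡ (·t-⊛ u Q W n))

  -- Recurrences Y = P + v t Y, i.e. Y = P / (1 − v t), are preserved by convolution.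
  ⊛-recurrenceˡ : ∀ W {Y P v} → Y ≋ P ⊕ v ·t Y → W ⊛ Y ≋ W ⊛ P ⊕ v ·t (W ⊛ Y)
  ⊛-recurrenceˡ W {Y} {P} {v} Y≋ n = trans (⊛-cong {W} (λ _ → refl) Y≋ n) (⊛-linearˡ W P Y v n)

  ⊛-recurrenceʳ : ∀ W {Y P v} → Y ≋ P ⊕ v ·t Y → Y ⊛ W ≋ P ⊛ W ⊕ v ·t (Y ⊛ W)
  ⊛-recurrenceʳ W {Y} {P} {v} Y≋ n = trans (⊛-cong {Y′ = W} Y≋ (λ _ → refl) n) (⊛-linearʳ W P Y v n)

  -- Xn = (1 + u t) Xo and Yn = Yo / (1 − v t) give Xn Yn = (1 + u t) / (1 − v t) · Xo Yo.
  ⊛-ratio : ∀ {Xn Xo Yn Yo u v} → Xn ≋ Xo ⊕ u ·t Xo → Yn ≋ Yo ⊕ v ·t Yn →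
            Xn ⊛ Yn ≋ Xo ⊛ Yo ⊕ u ·t (Xo ⊛ Yo) ⊕ v ·t (Xn ⊛ Yn)
  ⊛-ratio {Xn} {Xo} {Yn} {Yo} {u} Xn≋ Yn≋ n =
    trans (⊛-recurrenceˡ Xn Yn≋ n)
          (+-congʳ (trans (⊛-cong {Y′ = Yo} Xn≋ (λ _ → refl) n) (⊛-linearʳ Yo Xo Xo u n)))

  ⊛-ratioˡ : ∀ W {Zn Zo u v} → Zn ≋ Zo ⊕ u ·t Zo ⊕ v ·t Zn →
             W ⊛ Zn ≋ W ⊛ Zo ⊕ u ·t (W ⊛ Zo) ⊕ v ·t (W ⊛ Zn)
  ⊛-ratioˡ W {Zn} {Zo} {u} Zn≋ n = trans (⊛-recurrenceˡ W Zn≋ n) (+-congʳ (⊛-linearˡ W Zo Zo u n))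

  recurrence-unique : ∀ {Y Y′ P P′ v v′} → Y ≋ P ⊕ v ·t Y → Y′ ≋ P′ ⊕ v′ ·t Y′ →
                      P ≋ P′ → v ≈ v′ → Y ≋ Y′
  recurrence-unique Y≋ Y′≋ P≋P′ v≈v′ zero    =
    trans (Y≋ 0) (trans (+-cong (P≋P′ 0) refl) (sym (Y′≋ 0)))
  recurrence-unique Y≋ Y′≋ P≋P′ v≈v′ (suc n) =
    trans (Y≋ (suc n))
      (trans (+-cong (P≋P′ (suc n)) (*-cong v≈v′ (recurrence-unique Y≋ Y′≋ P≋P′ v≈v′ n)))
             (sym (Y′≋ (suc n))))

  ratio-unique : ∀ {Zn Zn′ Zo Zo′ u u′ v v′} →
                 Zn ≋ Zo ⊕ u ·t Zo ⊕ v ·t Zn → Zn′ ≋ Zo′ ⊕ u′ ·t Zo′ ⊕ v′ ·t Zn′ →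
                 Zo ≋ Zo′ → u ≈ u′ → v ≈ v′ → Zn ≋ Zn′
  ratio-unique Zn≋ Zn′≋ Zo≋Zo′ u≈u′ v≈v′ =
    recurrence-unique Zn≋ Zn′≋ (⊕-cong Zo≋Zo′ (·t-cong u≈u′ Zo≋Zo′)) v≈v′

module GaussianBinomials {ℓ₁ ℓ₂} (R : CommutativeRing ℓ₁ ℓ₂) where
  open CommutativeRing R hiding (zero)
  open import Relation.Binary.Reasoning.Setoid setoid
  open import Algebra.Solver.Ring.NaturalCoefficients.Default commutativeSemiring
    using (solve; _:=_; _:+_; _:*_; con)

  infixr 8 _^_
  _^_ : Carrier → ℕ → Carrier
  _^_ = pow R

  ^-+ : ∀ x m n → x ^ (m +ℕ n) ≈ x ^ m * x ^ n
  ^-+ x zero    n = sym (*-identityˡ _)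
  ^-+ x (suc m) n = trans (*-congˡ (^-+ x m n)) (sym (*-assoc x _ _))

  ^-distrib-* : ∀ x y n → (x * y) ^ n ≈ x ^ n * y ^ n
  ^-distrib-* x y zero    = sym (*-identityˡ 1#)
  ^-distrib-* x y (suc n) = trans (*-congˡ (^-distrib-* x y n)) (*-interchange x y _ _)
    where open import Algebra.Properties.CommutativeSemigroup *-commutativeSemigroup
            using () renaming (interchange to *-interchange)

  ^-congˡ : ∀ {x y} n → x ≈ y → x ^ n ≈ y ^ n
  ^-congˡ zero    x≈y = refl
  ^-congˡ (suc n) x≈y = *-cong x≈y (^-congˡ n x≈y)

  1^n≈1 : ∀ n → 1# ^ n ≈ 1#
  1^n≈1 zero    = refl
  1^n≈1 (suc n) = trans (*-identityˡ _) (1^n≈1 n)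

  binom2-suc : ∀ m → binom2 (suc m) ≡ binom2 m +ℕ m
  binom2-suc m = ≡.trans (≡.sym (nCk+nC[k+1]≡[n+1]C[k+1] m 1))
                         (≡.trans (≡.cong (_+ℕ binom2 m) (nC1≡n m)) (ℕₚ.+-comm m (binom2 m)))
    where open import Data.Nat.Combinatorics using (nCk+nC[k+1]≡[n+1]C[k+1]; nC1≡n)

  ^-binom2-suc : ∀ x m → x ^ binom2 (suc m) ≈ x ^ binom2 m * x ^ m
  ^-binom2-suc x m = trans (reflexive (≡.cong (x ^_) (binom2-suc m))) (^-+ x (binom2 m) m)

  module _ (q : Carrier) where

    gauss-< : ∀ {n k} → n < k → gauss R q n k ≈ 0#
    gauss-< {zero}  {suc k} _         = refl
    gauss-< {suc n} {suc k} (s≤s n<k) =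
      trans (+-cong (gauss-< n<k) (trans (*-congˡ (gauss-< (ℕₚ.m<n⇒m<1+n n<k))) (zeroʳ _)))
            (+-identityʳ 0#)

    gauss-diag : ∀ n → gauss R q n n ≈ 1#
    gauss-diag zero    = refl
    gauss-diag (suc n) =
      trans (+-cong (gauss-diag n) (trans (*-congˡ (gauss-< (ℕₚ.n<1+n n))) (zeroʳ _)))
            (+-identityʳ 1#)

    -- The defining recurrence peels q^(k+1) off the second term; this is its mirror image.
    gauss-pascal-dual : ∀ b a → gauss R q (suc (a +ℕ b)) (suc a)
                                ≈ q ^ b * gauss R q (a +ℕ b) a + gauss R q (a +ℕ b) (suc a)
    gauss-pascal-dual zero a rewrite ℕₚ.+-identityʳ a = begin
      gauss R q (suc a) (suc a)                      ≈⟨ gauss-diag (suc a) ⟩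
      1#                                             ≈⟨ sym (+-identityʳ 1#) ⟩
      1# + 0#                                        ≈⟨ sym (+-cong (trans (*-identityˡ _) (gauss-diag a))
                                                                   (gauss-< (ℕₚ.n<1+n a))) ⟩
      1# * gauss R q a a + gauss R q a (suc a)       ∎
    gauss-pascal-dual (suc b) zero = begin
      1# + (q * 1#) * gauss R q (suc b) 1
        ≈⟨ +-congˡ (*-congˡ (gauss-pascal-dual b zero)) ⟩
      1# + (q * 1#) * (q ^ b * 1# + gauss R q b 1)
        ≈⟨ solve 3 (λ q qᵇ g → (con 1 :+ (q :* con 1) :* (qᵇ :* con 1 :+ g))
                             := ((q :* qᵇ) :* con 1 :+ (con 1 :+ (q :* con 1) :* g))) refl q (q ^ b) (gauss R q b 1) ⟩
      (q * q ^ b) * 1# + (1# + (q * 1#) * gauss R q b 1) ∎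
    gauss-pascal-dual (suc b) (suc a) = begin
      gauss R q (suc n) (suc a) + q ^ suc (suc a) * gauss R q (suc n) (suc (suc a))
        ≈⟨ +-cong (gauss-pascal-dual (suc b) a) (*-congˡ shifted) ⟩
      (q ^ suc b * X + Y) + (q * (q * qᵃ)) * (qᵇ * Y + Z)
        ≈⟨ solve 6 (λ q qᵃ qᵇ X Y Z →
             (((q :* qᵇ) :* X :+ Y) :+ (q :* (q :* qᵃ)) :* (qᵇ :* Y :+ Z)) :=
             ((q :* qᵇ) :* (X :+ (q :* qᵃ) :* Y) :+ (Y :+ (q :* (q :* qᵃ)) :* Z))) refl q qᵃ qᵇ X Y Z ⟩
      q ^ suc b * gauss R q (suc n) (suc a) + gauss R q (suc n) (suc (suc a)) ∎
      where
      n = a +ℕ suc b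
      qᵃ = q ^ a
      qᵇ = q ^ b
      X = gauss R q n a
      Y = gauss R q n (suc a)
      Z = gauss R q n (suc (suc a))
      shifted : gauss R q (suc n) (suc (suc a)) ≈ qᵇ * Y + Z
      shifted = ≡.subst (λ m → gauss R q (suc m) (suc (suc a)) ≈ qᵇ * gauss R q m (suc a) + gauss R q m (suc (suc a)))
                        (≡.sym (ℕₚ.+-suc a b)) (gauss-pascal-dual b (suc a))

    -- The q-Pascal rule in the form satisfied by the coefficients of ∏_{i<M} (1 + x q^i t).
    gauss-pascal-binom2 : ∀ M m →
      gauss R q (suc M) (suc m) * q ^ binom2 (suc m)
        ≈ gauss R q M (suc m) * q ^ binom2 (suc m) + q ^ M * (gauss R q M m * q ^ binom2 m)
    gauss-pascal-binom2 M m with m ℕₚ.≤? M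
    ... | no m≰M = begin
      gauss R q (suc M) (suc m) * q ^ binom2 (suc m)
        ≈⟨ trans (*-congʳ (gauss-< (s≤s M<m))) (zeroˡ _) ⟩
      0#
        ≈⟨ sym (+-identityʳ 0#) ⟩
      0# + 0#
        ≈⟨ sym (+-cong (trans (*-congʳ (gauss-< (ℕₚ.m<n⇒m<1+n M<m))) (zeroˡ _))
                       (trans (*-congˡ (trans (*-congʳ (gauss-< M<m)) (zeroˡ _))) (zeroʳ _))) ⟩
      gauss R q M (suc m) * q ^ binom2 (suc m) + q ^ M * (gauss R q M m * q ^ binom2 m) ∎
      where M<m = ℕₚ.≰⇒> m≰M
    ... | yes m≤M with ℕₚ.m≤n⇒∃[o]m+o≡n m≤M
    ... | b , ≡.refl = begin
      gauss R q (suc (m +ℕ b)) (suc m) * q ^ binom2 (suc m)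
        ≈⟨ *-cong (gauss-pascal-dual b m) (^-binom2-suc q m) ⟩
      (q ^ b * X + Y) * (C * q ^ m)
        ≈⟨ solve 5 (λ qᵇ X Y C qᵐ → ((qᵇ :* X :+ Y) :* (C :* qᵐ)) := (Y :* (C :* qᵐ) :+ (qᵐ :* qᵇ) :* (X :* C)))
                   refl (q ^ b) X Y C (q ^ m) ⟩
      Y * (C * q ^ m) + (q ^ m * q ^ b) * (X * C)
        ≈⟨ +-cong (*-congˡ (sym (^-binom2-suc q m))) (*-congʳ (sym (^-+ q m b))) ⟩
      Y * q ^ binom2 (suc m) + q ^ (m +ℕ b) * (X * C) ∎
      where
      X = gauss R q (m +ℕ b) m
      Y = gauss R q (m +ℕ b) (suc m)
      C = q ^ binom2 m

-- A x M and B x M are the coefficient sequences of ∏_{i<M} (1 + x Q^i t) and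
-- ∏_{i<M} (1 − x Q^i t)⁻¹ (q-binomial theorem); we only need their recurrences in M.
module ProductSequences {ℓ₁ ℓ₂} (R : CommutativeRing ℓ₁ ℓ₂) (Q : CommutativeRing.Carrier R) where
  open CommutativeRing R hiding (zero)
  open import Relation.Binary.Reasoning.Setoid setoid
  open import Algebra.Solver.Ring.NaturalCoefficients.Default commutativeSemiring
    using (solve; _:=_; _:+_; _:*_)
  open Sequences R
  open GaussianBinomials R

  A : Carrier → ℕ → Seq
  A x M m = gauss R Q M m * x ^ m * Q ^ binom2 m

  B : Carrier → ℕ → Seq
  B x M m = gauss R Q (M +ℕ m ∸ 1) m * x ^ m

  A-suc : ∀ x M → A x (suc M) ≋ A x M ⊕ (x * Q ^ M) ·t A x M
  A-suc x M zero    = sym (+-identityʳ _)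
  A-suc x M (suc m) = begin
    G * (x * xᵐ) * C′
      ≈⟨ solve 4 (λ G x xᵐ C′ → G :* (x :* xᵐ) :* C′ := (x :* xᵐ) :* (G :* C′)) refl G x xᵐ C′ ⟩
    (x * xᵐ) * (G * C′)
      ≈⟨ *-congˡ (gauss-pascal-binom2 Q M m) ⟩
    (x * xᵐ) * (G′ * C′ + Qᴹ * (G₀ * C))
      ≈⟨ solve 7 (λ x xᵐ G′ C′ Qᴹ G₀ C → (x :* xᵐ) :* (G′ :* C′ :+ Qᴹ :* (G₀ :* C))
                                          := G′ :* (x :* xᵐ) :* C′ :+ (x :* Qᴹ) :* (G₀ :* xᵐ :* C))
                 refl x xᵐ G′ C′ Qᴹ G₀ C ⟩
    G′ * (x * xᵐ) * C′ + (x * Qᴹ) * (G₀ * xᵐ * C) ∎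
    where
    G = gauss R Q (suc M) (suc m)
    G′ = gauss R Q M (suc m)
    G₀ = gauss R Q M m
    xᵐ = x ^ m
    C = Q ^ binom2 m
    C′ = Q ^ binom2 (suc m)
    Qᴹ = Q ^ M

  B-suc : ∀ x M → B x (suc M) ≋ B x M ⊕ (x * Q ^ M) ·t B x (suc M)
  B-suc x M       zero    = sym (+-identityʳ _)
  B-suc x zero    (suc m) = begin
    gauss R Q (suc m) (suc m) * (x * x ^ m)
      ≈⟨ trans (*-congʳ (gauss-diag Q (suc m))) (*-identityˡ _) ⟩
    x * x ^ m
      ≈⟨ sym (+-identityˡ _) ⟩
    0# + x * x ^ m
      ≈⟨ +-cong (sym (trans (*-congʳ (gauss-< Q (ℕₚ.n<1+n m))) (zeroˡ _)))
                (sym (*-cong (*-identityʳ x) (trans (*-congʳ (gauss-diag Q m)) (*-identityˡ _)))) ⟩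
    gauss R Q m (suc m) * (x * x ^ m) + (x * 1#) * (gauss R Q m m * x ^ m) ∎
  B-suc x (suc M) (suc m) = begin
    gauss R Q (suc M +ℕ suc m) (suc m) * (x * xᵐ)
      ≈⟨ *-congʳ upper ⟩
    (G′ + Qᴹ * G₀) * (x * xᵐ)
      ≈⟨ solve 5 (λ G′ Qᴹ G₀ x xᵐ → (G′ :+ Qᴹ :* G₀) :* (x :* xᵐ)
                                   := G′ :* (x :* xᵐ) :+ (x :* Qᴹ) :* (G₀ :* xᵐ)) refl G′ Qᴹ G₀ x xᵐ ⟩
    G′ * (x * xᵐ) + (x * Qᴹ) * (G₀ * xᵐ) ∎
    where
    xᵐ = x ^ m
    G′ = gauss R Q (M +ℕ suc m) (suc m)
    G₀ = gauss R Q (suc M +ℕ m) m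
    Qᴹ = Q ^ suc M
    n≡ : M +ℕ suc m ≡ m +ℕ suc M
    n≡ = ≡.trans (ℕₚ.+-comm M (suc m)) (≡.sym (ℕₚ.+-suc m M))
    n≡′ : suc M +ℕ m ≡ m +ℕ suc M
    n≡′ = ≡.trans (≡.cong suc (ℕₚ.+-comm M m)) (≡.sym (ℕₚ.+-suc m M))
    upper : gauss R Q (suc M +ℕ suc m) (suc m) ≈ G′ + Qᴹ * G₀
    upper = begin
      gauss R Q (suc (M +ℕ suc m)) (suc m)
        ≡⟨ ≡.cong (λ n → gauss R Q (suc n) (suc m)) n≡ ⟩
      gauss R Q (suc (m +ℕ suc M)) (suc m)
        ≈⟨ gauss-pascal-dual Q (suc M) m ⟩
      Qᴹ * gauss R Q (m +ℕ suc M) m + gauss R Q (m +ℕ suc M) (suc m)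
        ≈⟨ +-comm _ _ ⟩
      gauss R Q (m +ℕ suc M) (suc m) + Qᴹ * gauss R Q (m +ℕ suc M) m
        ≡⟨ ≡.cong₂ (λ n n′ → gauss R Q n (suc m) + Qᴹ * gauss R Q n′ m) (≡.sym n≡) (≡.sym n≡′) ⟩
      G′ + Qᴹ * G₀ ∎

  A-head : ∀ x M → A x M 0 ≈ 1#
  A-head x M = trans (*-identityʳ _) (*-identityʳ _)

  B-head : ∀ x M → B x M 0 ≈ 1#
  B-head x M = *-identityʳ _

  A-empty : ∀ x i → A x 0 (suc i) ≈ 0#
  A-empty x i = trans (*-congʳ (zeroˡ _)) (zeroˡ _)

  B-empty : ∀ x i → B x 0 (suc i) ≈ 0#
  B-empty x i = trans (*-congʳ (gauss-< Q (ℕₚ.n<1+n i))) (zeroˡ _)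

  B-ones : ∀ m → B 1# 1 m ≈ 1#
  B-ones m = trans (*-cong (gauss-diag Q m) (1^n≈1 m)) (*-identityˡ 1#)

module Compositions {ℓ₁ ℓ₂} (R : CommutativeRing ℓ₁ ℓ₂) where
  open CommutativeRing R hiding (zero)
  open import Relation.Binary.Reasoning.Setoid setoid
  open FiniteSums R
  open Sequences R

  grid4 : ℕ → List (ℕ × ℕ × ℕ × ℕ)
  grid4 n = concatMap (λ m₁ → concatMap (λ m₂ → concatMap (λ m₃ →
              map (λ m₄ → (m₁ , m₂ , m₃ , m₄)) (upTo n)) (upTo n)) (upTo n)) (upTo n)

  ∑ᴸ-grid4 : ∀ n (g : ℕ × ℕ × ℕ × ℕ → Carrier) →
             ∑ᴸ g (grid4 n) ≈ ∑< n λ m₁ → ∑< n λ m₂ → ∑< n λ m₃ → ∑< n λ m₄ → g (m₁ , m₂ , m₃ , m₄)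
  ∑ᴸ-grid4 n g =
    trans (∑ᴸ-concatMap-upTo g _ n) (∑<-cong n λ m₁ →
    trans (∑ᴸ-concatMap-upTo g _ n) (∑<-cong n λ m₂ →
    trans (∑ᴸ-concatMap-upTo g _ n) (∑<-cong n λ m₃ →
    ∑ᴸ-map-upTo g (λ m₄ → (m₁ , m₂ , m₃ , m₄)) n)))

  sum4-expand : ∀ N f → sum4 R N f ≈ ∑< (suc N) λ m₁ → ∑< (suc N) λ m₂ → ∑< (suc N) λ m₃ → ∑< (suc N) λ m₄ →
                                        [ m₁ +ℕ m₂ +ℕ m₃ +ℕ m₄ ≡ᵇ N ]* f m₁ m₂ m₃ m₄
  sum4-expand N f =
    trans (∑ᴸ-filter (λ { (m₁ , m₂ , m₃ , m₄) → m₁ +ℕ m₂ +ℕ m₃ +ℕ m₄ ℕₚ.≟ N })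
                     (λ { (m₁ , m₂ , m₃ , m₄) → f m₁ m₂ m₃ m₄ }) (grid4 (suc N)))
          (∑ᴸ-grid4 (suc N) _)

  truncAt : ℕ → Seq → ℕ → Carrier
  truncAt N X s = [ s <ᵇ suc N ]* X (N ∸ s)

  ∑<-⊛ : ∀ N s X Y → ∑< (suc N) (λ m → X m * truncAt N Y (s +ℕ m)) ≈ truncAt N (X ⊛ Y) s
  ∑<-⊛ N s X Y = begin
    ∑< (suc N) (λ m → X m * truncAt N Y (s +ℕ m))
      ≈⟨ ∑<-cong (suc N) (λ m → trans (sym ([]*-*ˡ (s +ℕ m <ᵇ suc N) (X m) _))
                                       ([]*-cong (s +ℕ m <ᵇ suc N) (*-congˡ (reflexive (≡.cong Y (∸-+ m)))))) ⟩
    ∑< (suc N) (λ m → [ s +ℕ m <ᵇ suc N ]* (X m * Y (N ∸ s ∸ m)))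
      ≈⟨ ∑<-<ᵇ N s (λ m → X m * Y (N ∸ s ∸ m)) ⟩
    truncAt N (X ⊛ Y) s ∎
    where
    ∸-+ : ∀ m → N ∸ (s +ℕ m) ≡ N ∸ s ∸ m
    ∸-+ m = ≡.sym (ℕₚ.∸-+-assoc N s m)

  -- Summing out m₄, m₃, m₂, m₁ in turn leaves convolutions evaluated at N − m₁ − ⋯.
  sum4≈⊛ : ∀ N f (W X Y Z : Seq) → (∀ m₁ m₂ m₃ m₄ → f m₁ m₂ m₃ m₄ ≈ W m₁ * (X m₂ * (Y m₃ * Z m₄))) →
           sum4 R N f ≈ (W ⊛ X ⊛ Y ⊛ Z) N
  sum4≈⊛ N f W X Y Z f≈ = begin
    sum4 R N f
      ≈⟨ sum4-expand N f ⟩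
    ∑< (suc N) (λ m₁ → ∑< (suc N) λ m₂ → ∑< (suc N) λ m₃ → ∑< (suc N) λ m₄ →
      [ m₁ +ℕ m₂ +ℕ m₃ +ℕ m₄ ≡ᵇ N ]* f m₁ m₂ m₃ m₄)
      ≈⟨ ∑<-cong (suc N) (λ m₁ → ∑<-cong (suc N) λ m₂ → ∑<-cong (suc N) λ m₃ → sum-m₄ m₁ m₂ m₃) ⟩
    ∑< (suc N) (λ m₁ → ∑< (suc N) λ m₂ → ∑< (suc N) λ m₃ →
      W m₁ * (X m₂ * (Y m₃ * truncAt N Z (m₁ +ℕ m₂ +ℕ m₃))))
      ≈⟨ ∑<-cong (suc N) (λ m₁ → ∑<-cong (suc N) λ m₂ → sum-m₃ m₁ m₂) ⟩
    ∑< (suc N) (λ m₁ → ∑< (suc N) λ m₂ → W m₁ * (X m₂ * truncAt N (Y ⊛ Z) (m₁ +ℕ m₂)))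
      ≈⟨ ∑<-cong (suc N) sum-m₂ ⟩
    ∑< (suc N) (λ m₁ → W m₁ * truncAt N (X ⊛ Y ⊛ Z) m₁)
      ≈⟨ ∑<-⊛ N 0 W (X ⊛ Y ⊛ Z) ⟩
    (W ⊛ X ⊛ Y ⊛ Z) N ∎
    where
    sum-m₄ : ∀ m₁ m₂ m₃ → ∑< (suc N) (λ m₄ → [ m₁ +ℕ m₂ +ℕ m₃ +ℕ m₄ ≡ᵇ N ]* f m₁ m₂ m₃ m₄)
                          ≈ W m₁ * (X m₂ * (Y m₃ * truncAt N Z (m₁ +ℕ m₂ +ℕ m₃)))
    sum-m₄ m₁ m₂ m₃ = begin
      ∑< (suc N) (λ m₄ → [ b m₄ ]* f m₁ m₂ m₃ m₄)
        ≈⟨ ∑<-cong (suc N) (λ m₄ → trans ([]*-cong (b m₄) (f≈ m₁ m₂ m₃ m₄))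
                                   (trans ([]*-*ˡ (b m₄) (W m₁) (X m₂ * (Y m₃ * Z m₄)))
                                   (*-congˡ (trans ([]*-*ˡ (b m₄) (X m₂) (Y m₃ * Z m₄))
                                                   (*-congˡ ([]*-*ˡ (b m₄) (Y m₃) (Z m₄))))))) ⟩
      ∑< (suc N) (λ m₄ → W m₁ * (X m₂ * (Y m₃ * [ b m₄ ]* Z m₄)))
        ≈⟨ trans (∑<-*ˡ (suc N) (W m₁) (λ m₄ → X m₂ * (Y m₃ * [ b m₄ ]* Z m₄)))
                 (*-congˡ (trans (∑<-*ˡ (suc N) (X m₂) (λ m₄ → Y m₃ * [ b m₄ ]* Z m₄))
                                 (*-congˡ (∑<-*ˡ (suc N) (Y m₃) (λ m₄ → [ b m₄ ]* Z m₄))))) ⟩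
      W m₁ * (X m₂ * (Y m₃ * ∑< (suc N) (λ m₄ → [ b m₄ ]* Z m₄)))
        ≈⟨ *-congˡ (*-congˡ (*-congˡ (∑<-≡ᵇ N (m₁ +ℕ m₂ +ℕ m₃) Z))) ⟩
      W m₁ * (X m₂ * (Y m₃ * truncAt N Z (m₁ +ℕ m₂ +ℕ m₃))) ∎
      where
      b : ℕ → Bool
      b m₄ = m₁ +ℕ m₂ +ℕ m₃ +ℕ m₄ ≡ᵇ N

    sum-m₃ : ∀ m₁ m₂ → ∑< (suc N) (λ m₃ → W m₁ * (X m₂ * (Y m₃ * truncAt N Z (m₁ +ℕ m₂ +ℕ m₃))))
                       ≈ W m₁ * (X m₂ * truncAt N (Y ⊛ Z) (m₁ +ℕ m₂))
    sum-m₃ m₁ m₂ =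
      trans (∑<-*ˡ (suc N) (W m₁) (λ m₃ → X m₂ * (Y m₃ * truncAt N Z (m₁ +ℕ m₂ +ℕ m₃))))
            (*-congˡ (trans (∑<-*ˡ (suc N) (X m₂) (λ m₃ → Y m₃ * truncAt N Z (m₁ +ℕ m₂ +ℕ m₃)))
                            (*-congˡ (∑<-⊛ N (m₁ +ℕ m₂) Y Z))))

    sum-m₂ : ∀ m₁ → ∑< (suc N) (λ m₂ → W m₁ * (X m₂ * truncAt N (Y ⊛ Z) (m₁ +ℕ m₂)))
                    ≈ W m₁ * truncAt N (X ⊛ Y ⊛ Z) m₁
    sum-m₂ m₁ = trans (∑<-*ˡ (suc N) (W m₁) (λ m₂ → X m₂ * truncAt N (Y ⊛ Z) (m₁ +ℕ m₂)))
                      (*-congˡ (∑<-⊛ N m₁ X (Y ⊛ Z)))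

module S2Lists where
  open import Data.List.Relation.Unary.All as All using (All; []; _∷_)
  open import Data.List.Relation.Unary.All.Properties using (filter⁺)
  open import Data.List.Relation.Unary.AllPairs as AllPairs using (_∷_)
  open import Data.List.Relation.Unary.Linked as Linked using (Linked; [-]; _∷_)
  open import Data.List.Relation.Unary.Linked.Properties using (Linked⇒AllPairs)
  open import Data.List.Relation.Unary.Unique.DecPropositional ℕₚ._≟_ using (Unique)
  open import Data.List.Properties using (filter-accept; filter-reject)
  open import Data.Empty using (⊥-elim)
  open import Relation.Nullary.Negation.Core using (¬_)

  -- 2⌊l/2⌋: the largest part allowed after a part l, since odd parts may not repeat.
  evenFloor : ℕ → ℕ
  evenFloor zero          = zero
  evenFloor (suc zero)    = zero
  evenFloor (suc (suc l)) = suc (suc (evenFloor l))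

  evenFloor-≤ : ∀ l → evenFloor l ≤ l
  evenFloor-≤ zero          = z≤n
  evenFloor-≤ (suc zero)    = z≤n
  evenFloor-≤ (suc (suc l)) = s≤s (s≤s (evenFloor-≤ l))

  evenFloor-odd : ∀ l → IsOdd l → suc (evenFloor l) ≡ l
  evenFloor-odd (suc zero)    _     = ≡.refl
  evenFloor-odd (suc (suc l)) odd-l = ≡.cong (suc ∘ suc) (evenFloor-odd l odd-l)

  evenFloor-even : ∀ l → ¬ IsOdd l → evenFloor l ≡ l
  evenFloor-even zero          _      = ≡.refl
  evenFloor-even (suc zero)    ¬odd-l = ⊥-elim (¬odd-l ≡.refl)
  evenFloor-even (suc (suc l)) ¬odd-l = ≡.cong (suc ∘ suc) (evenFloor-even l ¬odd-l)

  private
    ≤-evenFloor : ∀ {e l} → IsOdd l → e ≤ l → e ≢ l → e ≤ evenFloor l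
    ≤-evenFloor {e} {l} odd-l e≤l e≢l =
      ℕₚ.≤-pred (≡.subst (suc e ≤_) (≡.sym (evenFloor-odd l odd-l)) (ℕₚ.≤∧≢⇒< e≤l e≢l))

    evenFloor-≢ : ∀ {e l} → IsOdd l → e ≤ evenFloor l → l ≢ e
    evenFloor-≢ {e} {l} odd-l e≤ l≡e =
      ℕₚ.<-irrefl ≡.refl (≡.subst (suc e ≤_) (≡.trans (evenFloor-odd l odd-l) l≡e) (s≤s e≤))

    below-odd : ∀ {l} es → IsOdd l → All (_≤ l) es → All (l ≢_) (oddParts es) → All (_≤ evenFloor l) es
    below-odd []       odd-l []          _  = []
    below-odd (e ∷ es) odd-l (e≤l ∷ es≤l) ≢l with isOdd? e
    ... | yes odd-e = ≤-evenFloor odd-l e≤l (λ e≡l → All.head ≢l′ (≡.sym e≡l))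
                      ∷ below-odd es odd-l es≤l (All.tail ≢l′)
      where ≢l′ = ≡.subst (All _) (filter-accept isOdd? {e} {es} odd-e) ≢l
    ... | no ¬odd-e = ≤-evenFloor odd-l e≤l (λ e≡l → ¬odd-e (≡.subst IsOdd (≡.sym e≡l) odd-l))
                      ∷ below-odd es odd-l es≤l (≡.subst (All _) (filter-reject isOdd? {e} {es} ¬odd-e) ≢l)

  IsS2-∷⁻ : ∀ l ls → IsS2 (l ∷ ls) → IsS2 ls × All (_≤ evenFloor l) ls
  IsS2-∷⁻ l ls (sorted , unique) with isOdd? l
  ... | yes odd-l = (Linked.tail sorted , AllPairs.tail unique′) ,
                    below-odd ls odd-l ls≤l (AllPairs.head unique′)
    where unique′ = ≡.subst Unique (filter-accept isOdd? {l} {ls} odd-l) unique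
          ls≤l = AllPairs.head (Linked⇒AllPairs (λ p q → ℕₚ.≤-trans q p) sorted)
  ... | no ¬odd-l = (Linked.tail sorted , ≡.subst Unique (filter-reject isOdd? {l} {ls} ¬odd-l) unique) ,
                    ≡.subst (λ b → All (_≤ b) ls) (≡.sym (evenFloor-even l ¬odd-l)) ls≤l
    where ls≤l = AllPairs.head (Linked⇒AllPairs (λ p q → ℕₚ.≤-trans q p) sorted)

  IsS2-∷⁺ : ∀ l ls → IsS2 ls → All (_≤ evenFloor l) ls → IsS2 (l ∷ ls)
  IsS2-∷⁺ l ls (sorted , unique) ls≤ = sorted′ ls sorted ls≤ , unique′
    where
    sorted′ : ∀ ks → Linked _≥_ ks → All (_≤ evenFloor l) ks → Linked _≥_ (l ∷ ks)
    sorted′ []       _ _         = [-]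
    sorted′ (k ∷ ks) s (k≤ ∷ _) = ℕₚ.≤-trans k≤ (evenFloor-≤ l) ∷ s
    unique′ : Unique (oddParts (l ∷ ls))
    unique′ with isOdd? l
    ... | yes odd-l = ≡.subst Unique (≡.sym (filter-accept isOdd? {l} {ls} odd-l))
                        (filter⁺ isOdd? (All.map (evenFloor-≢ odd-l) ls≤) ∷ unique)
    ... | no ¬odd-l = ≡.subst Unique (≡.sym (filter-reject isOdd? {l} {ls} ¬odd-l)) unique

module Partitions {ℓ₁ ℓ₂} (R : CommutativeRing ℓ₁ ℓ₂) where
  open CommutativeRing R hiding (zero)
  open import Relation.Binary.Reasoning.Setoid setoid
  open import Algebra.Solver.Ring.NaturalCoefficients.Default commutativeSemiring
    using (solve; _:=_; _:+_; _:*_; con)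
  open import Data.List.Relation.Unary.All using (All; all?)
  open import Data.Empty using (⊥-elim)
  open FiniteSums R
  open S2Lists

  -- Recursion on the first part l; the remaining rows swap the labels (a,b) and (c,d).
  genS2′ : Carrier → Carrier → Carrier → Carrier → ℕ → ℕ → Carrier
  genS2′ x y z w N zero    = 1#
  genS2′ x y z w N (suc M) = ∑< (suc N) (λ l → rowWeight R x y l * genS2′ z w x y (evenFloor l) M)

  private
    rw : Carrier → Carrier → ℕ → Carrier
    rw = rowWeight R

  ∑ᴸ-boundedLists-suc : ∀ m N (f : List ℕ → Carrier) →
                        ∑ᴸ f (boundedLists (suc m) N) ≈ ∑< (suc N) (λ l → ∑ᴸ (f ∘ (l ∷_)) (boundedLists m N))
  ∑ᴸ-boundedLists-suc m N f =
    trans (∑ᴸ-concatMap-upTo f (λ l → map (l ∷_) (boundedLists m N)) (suc N))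
          (∑<-cong (suc N) (λ l → ∑ᴸ-map f (l ∷_) (boundedLists m N)))

  ∑ᴸ-boundedLists-restrict : ∀ m {B N} → B ≤ N → (f : List ℕ → Carrier) →
    ∑ᴸ (λ v → [ does (all? (_≤? B) v) ]* f v) (boundedLists m N) ≈ ∑ᴸ f (boundedLists m B)
  ∑ᴸ-boundedLists-restrict zero    B≤N f = refl
  ∑ᴸ-boundedLists-restrict (suc m) {B} {N} B≤N f = begin
    ∑ᴸ (λ v → [ does (all? (_≤? B) v) ]* f v) (boundedLists (suc m) N)
      ≈⟨ ∑ᴸ-boundedLists-suc m N _ ⟩
    ∑< (suc N) (λ l → ∑ᴸ (λ v → [ (l ≤ᵇ B) ∧ does (all? (_≤? B) v) ]* f (l ∷ v)) (boundedLists m N))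
      ≈⟨ ∑<-cong (suc N) first-part ⟩
    ∑< (suc N) (λ l → [ l ≤ᵇ B ]* ∑ᴸ (f ∘ (l ∷_)) (boundedLists m B))
      ≈⟨ ∑<-cong (suc N) (λ l → reflexive (≡.cong (λ b → [ b ]* ∑ᴸ (f ∘ (l ∷_)) (boundedLists m B))
                                                   (≤ᵇ≡<ᵇsuc l B))) ⟩
    ∑< (suc N) (λ l → [ l <ᵇ suc B ]* ∑ᴸ (f ∘ (l ∷_)) (boundedLists m B))
      ≈⟨ ∑<-truncate B N B≤N (λ l → ∑ᴸ (f ∘ (l ∷_)) (boundedLists m B)) ⟩
    ∑< (suc B) (λ l → ∑ᴸ (f ∘ (l ∷_)) (boundedLists m B))
      ≈⟨ sym (∑ᴸ-boundedLists-suc m B f) ⟩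
    ∑ᴸ f (boundedLists (suc m) B) ∎
    where
    []*-∧ : ∀ b c t → [ b ∧ c ]* t ≈ [ b ]* [ c ]* t
    []*-∧ true  c t = refl
    []*-∧ false c t = refl
    first-part : ∀ l → ∑ᴸ (λ v → [ (l ≤ᵇ B) ∧ does (all? (_≤? B) v) ]* f (l ∷ v)) (boundedLists m N)
                       ≈ [ l ≤ᵇ B ]* ∑ᴸ (f ∘ (l ∷_)) (boundedLists m B)
    first-part l =
      trans (∑ᴸ-cong (boundedLists m N) (λ v → []*-∧ (l ≤ᵇ B) (does (all? (_≤? B) v)) (f (l ∷ v))))
            (trans (∑ᴸ-[]* (l ≤ᵇ B) (λ v → [ does (all? (_≤? B) v) ]* f (l ∷ v)) (boundedLists m N))
                   ([]*-cong (l ≤ᵇ B) (∑ᴸ-boundedLists-restrict m B≤N (f ∘ (l ∷_)))))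
    ≤ᵇ≡<ᵇsuc : ∀ m n → (m ≤ᵇ n) ≡ (m <ᵇ suc n)
    ≤ᵇ≡<ᵇsuc zero    n = ≡.refl
    ≤ᵇ≡<ᵇsuc (suc m) n = ≡.refl

  []*-isS2-∷ : ∀ l ls t → [ does (isS2? (l ∷ ls)) ]* t ≈ [ does (all? (_≤? evenFloor l) ls) ]* [ does (isS2? ls) ]* t
  []*-isS2-∷ l ls t = by-cases (isS2? (l ∷ ls)) (isS2? ls) (all? (_≤? evenFloor l) ls)
    where
    by-cases : (p : Dec (IsS2 (l ∷ ls))) (q : Dec (IsS2 ls)) (r : Dec (All (_≤ evenFloor l) ls)) →
               [ does p ]* t ≈ [ does r ]* [ does q ]* t
    by-cases (yes _) (yes _) (yes _) = refl
    by-cases (yes p) (no ¬q) _       = ⊥-elim (¬q (proj₁ (IsS2-∷⁻ l ls p)))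
    by-cases (yes p) _       (no ¬r) = ⊥-elim (¬r (proj₂ (IsS2-∷⁻ l ls p)))
    by-cases (no ¬p) (yes q) (yes r) = ⊥-elim (¬p (IsS2-∷⁺ l ls q r))
    by-cases (no _)  (no _)  (yes _) = refl
    by-cases (no _)  _       (no _)  = refl

  genS2≈genS2′ : ∀ x y z w N M → genS2 R x y z w N M ≈ genS2′ x y z w N M
  genS2≈genS2′ x y z w N zero    = +-identityʳ 1#
  genS2≈genS2′ x y z w N (suc M) = begin
    ∑ᴸ (ω² R x y z w) (filter isS2? (boundedLists (suc M) N))
      ≈⟨ ∑ᴸ-filter isS2? (ω² R x y z w) (boundedLists (suc M) N) ⟩
    ∑ᴸ (λ v → [ does (isS2? v) ]* ω² R x y z w v) (boundedLists (suc M) N)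
      ≈⟨ ∑ᴸ-boundedLists-suc M N _ ⟩
    ∑< (suc N) (λ l → ∑ᴸ (λ v → [ does (isS2? (l ∷ v)) ]* (rw x y l * ω² R z w x y v)) (boundedLists M N))
      ≈⟨ ∑<-cong-< (suc N) (λ l l<1+N → rows-below l (ℕₚ.≤-pred l<1+N)) ⟩
    ∑< (suc N) (λ l → rw x y l * genS2′ z w x y (evenFloor l) M) ∎
    where
    rows-below : ∀ l → l ≤ N → ∑ᴸ (λ v → [ does (isS2? (l ∷ v)) ]* (rw x y l * ω² R z w x y v)) (boundedLists M N)
                               ≈ rw x y l * genS2′ z w x y (evenFloor l) M
    rows-below l l≤N = begin
      ∑ᴸ (λ v → [ does (isS2? (l ∷ v)) ]* (rw x y l * ω² R z w x y v)) (boundedLists M N)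
        ≈⟨ ∑ᴸ-cong (boundedLists M N) (λ v → []*-isS2-∷ l v _) ⟩
      ∑ᴸ (λ v → [ does (all? (_≤? evenFloor l) v) ]* [ does (isS2? v) ]* (rw x y l * ω² R z w x y v)) (boundedLists M N)
        ≈⟨ ∑ᴸ-boundedLists-restrict M (ℕₚ.≤-trans (evenFloor-≤ l) l≤N) _ ⟩
      ∑ᴸ (λ v → [ does (isS2? v) ]* (rw x y l * ω² R z w x y v)) (boundedLists M (evenFloor l))
        ≈⟨ trans (∑ᴸ-cong (boundedLists M (evenFloor l)) (λ v → []*-*ˡ (does (isS2? v)) (rw x y l) _))
                 (∑ᴸ-*ˡ (rw x y l) _ (boundedLists M (evenFloor l))) ⟩
      rw x y l * ∑ᴸ (λ v → [ does (isS2? v) ]* ω² R z w x y v) (boundedLists M (evenFloor l))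
        ≈⟨ *-congˡ (sym (∑ᴸ-filter isS2? (ω² R z w x y) (boundedLists M (evenFloor l)))) ⟩
      rw x y l * genS2 R z w x y (evenFloor l) M
        ≈⟨ *-congˡ (genS2≈genS2′ z w x y (evenFloor l) M) ⟩
      rw x y l * genS2′ z w x y (evenFloor l) M ∎

  genS2′-0 : ∀ x y z w M → genS2′ x y z w 0 M ≈ 1#
  genS2′-0 x y z w zero    = refl
  genS2′-0 x y z w (suc M) = trans (+-identityʳ _) (trans (*-identityˡ _) (genS2′-0 z w x y M))

  genS2′-1 : ∀ x y z w M → genS2′ x y z w 1 (suc M) ≈ 1# + x
  genS2′-1 x y z w M =
    +-cong (trans (*-identityˡ _) (genS2′-0 z w x y M))
           (trans (+-identityʳ _) (trans (*-congˡ (genS2′-0 z w x y M)) (trans (*-identityʳ _) (*-identityʳ x))))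

  -- Combinatorially, the partitions with exactly M + 1 parts lose their first two columns,
  -- of lengths M + 1 and M (last part 1) or M + 1. Formally: induction on M, applying the
  -- hypothesis, with the labels swapped, to the rows below a first row of length ≥ 2.
  genS2′-columns : ∀ x y z w N M →
    genS2′ x y z w (suc (suc N)) (suc M)
      ≈ genS2′ x y z w (suc (suc N)) M
        + (rw x z (suc M) * rw y w M) * genS2′ x y z w N M
        + (rw x z (suc M) * rw y w (suc M)) * genS2′ x y z w N (suc M)
  genS2′-columns x y z w N zero = begin
    1# * 1# + ((x * 1#) * 1# + ∑< (suc N) (λ l → (x * (y * rw x y l)) * 1#))
      ≈⟨ +-congˡ (+-congˡ (trans (∑<-cong (suc N) (λ l → *-assoc x (y * rw x y l) 1#))
                          (trans (∑<-*ˡ (suc N) x (λ l → y * rw x y l * 1#))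
                                 (*-congˡ (trans (∑<-cong (suc N) (λ l → *-assoc y (rw x y l) 1#))
                                                 (∑<-*ˡ (suc N) y (λ l → rw x y l * 1#))))))) ⟩
    1# * 1# + ((x * 1#) * 1# + x * (y * S))
      ≈⟨ solve 3 (λ x y S → con 1 :* con 1 :+ ((x :* con 1) :* con 1 :+ x :* (y :* S))
                          := con 1 :+ ((x :* con 1) :* con 1) :* con 1 :+ ((x :* con 1) :* (y :* con 1)) :* S) refl x y S ⟩
    1# + ((x * 1#) * 1#) * 1# + ((x * 1#) * (y * 1#)) * S ∎
    where S = ∑< (suc N) (λ l → rw x y l * 1#)
  genS2′-columns x y z w N (suc M) = begin
    1# * F′ 0 (suc M) + ((x * 1#) * F′ 0 (suc M) + Σ (suc M))
      ≈⟨ +-cong (*-congˡ F′0) (+-cong (*-congˡ F′0) Σ-suc) ⟩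
    1# * F′ 0 M + ((x * 1#) * F′ 0 M + (Σ M + (x * y * km) * F N (suc M) + (x * y * kf) * F N (suc (suc M))))
      ≈⟨ solve 12 (λ p q S x y z w A B C G₁ G₂ →
           p :+ (q :+ (S :+ (x :* y :* ((z :* A) :* C)) :* G₁ :+ (x :* y :* ((z :* A) :* (w :* B))) :* G₂))
           := p :+ (q :+ S) :+ ((x :* (z :* A)) :* (y :* C)) :* G₁ :+ ((x :* (z :* A)) :* (y :* (w :* B))) :* G₂)
           refl (1# * F′ 0 M) ((x * 1#) * F′ 0 M) (Σ M) x y z w
                (rw x z M) (rw y w M) (rw w y M) (F N (suc M)) (F N (suc (suc M))) ⟩
    F (suc (suc N)) (suc M) + (rw x z (suc (suc M)) * rw y w (suc M)) * F N (suc M)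
      + (rw x z (suc (suc M)) * rw y w (suc (suc M))) * F N (suc (suc M)) ∎
    where
    F F′ : ℕ → ℕ → Carrier
    F = genS2′ x y z w
    F′ = genS2′ z w x y
    km kf : Carrier
    km = rw z x (suc M) * rw w y M
    kf = rw z x (suc M) * rw w y (suc M)
    F′0 : F′ 0 (suc M) ≈ F′ 0 M
    F′0 = trans (genS2′-0 z w x y (suc M)) (sym (genS2′-0 z w x y M))
    Σ : ℕ → Carrier
    Σ K = ∑< (suc N) (λ l → (x * (y * rw x y l)) * F′ (suc (suc (evenFloor l))) K)
    split : ∀ l → (x * (y * rw x y l)) * F′ (suc (suc (evenFloor l))) (suc M)
                  ≈ (x * (y * rw x y l)) * F′ (suc (suc (evenFloor l))) M
                    + (x * y * km) * (rw x y l * F′ (evenFloor l) M)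
                    + (x * y * kf) * (rw x y l * F′ (evenFloor l) (suc M))
    split l = trans (*-congˡ (genS2′-columns z w x y (evenFloor l) M))
      (solve 8 (λ x y r P km U kf V → (x :* (y :* r)) :* (P :+ km :* U :+ kf :* V)
                                       := (x :* (y :* r)) :* P :+ (x :* y :* km) :* (r :* U) :+ (x :* y :* kf) :* (r :* V))
             refl x y (rw x y l) (F′ (suc (suc (evenFloor l))) M) km (F′ (evenFloor l) M) kf (F′ (evenFloor l) (suc M)))
    Σ-suc : Σ (suc M) ≈ Σ M + (x * y * km) * F N (suc M) + (x * y * kf) * F N (suc (suc M))
    Σ-suc = begin
      Σ (suc M)
        ≈⟨ ∑<-cong (suc N) split ⟩
      ∑< (suc N) (λ l → P l + (x * y * km) * U l + (x * y * kf) * V l)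
        ≈⟨ trans (∑<-+ (suc N) (λ l → P l + (x * y * km) * U l) (λ l → (x * y * kf) * V l))
                 (+-congʳ (∑<-+ (suc N) P (λ l → (x * y * km) * U l))) ⟩
      Σ M + ∑< (suc N) (λ l → (x * y * km) * U l) + ∑< (suc N) (λ l → (x * y * kf) * V l)
        ≈⟨ +-cong (+-congˡ (∑<-*ˡ (suc N) (x * y * km) U)) (∑<-*ˡ (suc N) (x * y * kf) V) ⟩
      Σ M + (x * y * km) * F N (suc M) + (x * y * kf) * F N (suc (suc M)) ∎
      where
      P U V : ℕ → Carrier
      P l = (x * (y * rw x y l)) * F′ (suc (suc (evenFloor l))) M
      U l = rw x y l * F′ (evenFloor l) M
      V l = rw x y l * F′ (evenFloor l) (suc M)

double : ℕ → ℕ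
double zero    = zero
double (suc n) = suc (suc (double n))

double≡2* : ∀ n → double n ≡ 2 *ℕ n
double≡2* zero    = ≡.refl
double≡2* (suc n) = ≡.cong suc (≡.trans (≡.cong suc (double≡2* n)) (≡.sym (ℕₚ.+-suc n (n +ℕ 0))))

module ProductFormula {ℓ₁ ℓ₂} (R : CommutativeRing ℓ₁ ℓ₂) (a b c d : CommutativeRing.Carrier R) where
  open CommutativeRing R hiding (zero)
  open import Relation.Binary.Reasoning.Setoid setoid
  open import Algebra.Solver.Ring.NaturalCoefficients.Default commutativeSemiring
    using (solve; _:=_; _:+_; _:*_)
  open Sequences R
  open GaussianBinomials R
  open Compositions R using (sum4≈⊛)
  open Partitions R

  Q : Carrier
  Q = a * b * c * d

  open ProductSequences R Q

  private
    rw : Carrier → Carrier → ℕ → Carrier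
    rw = rowWeight R

    ab abc : Carrier
    ab = a * b
    abc = a * b * c

  -- (1 + a) ∏_{i<M} (1 + a Q^(i+1) t)
  A₁ : ℕ → Seq
  A₁ M m = (1# + a) * A (a * Q) M m

  A₁-suc : ∀ M → A₁ (suc M) ≋ A₁ M ⊕ ((a * Q) * Q ^ M) ·t A₁ M
  A₁-suc M n = trans (*-congˡ (A-suc (a * Q) M n)) (trans (distribˡ (1# + a) _ _) (+-congˡ (scaled n)))
    where
    scaled : ∀ n → (1# + a) * (((a * Q) * Q ^ M) ·t A (a * Q) M) n ≈ (((a * Q) * Q ^ M) ·t A₁ M) n
    scaled zero    = zeroʳ _
    scaled (suc n) = x∙yz≈y∙xz (1# + a) _ _
      where open import Algebra.Properties.CommutativeSemigroup *-commutativeSemigroup using (x∙yz≈y∙xz)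

  -- With the parity p of the bound on the parts fixed, genS2′-columns becomes a
  -- recurrence between the sequences F p K and F p (suc K).
  F : ℕ → ℕ → Seq
  F p K n = genS2′ a b c d (double n +ℕ p) K

  F-column : ∀ p K → genS2′ a b c d p (suc K) ≈ genS2′ a b c d p K →
             F p (suc K) ≋ F p K ⊕ (rw a c (suc K) * rw b d K) ·t F p K
                                 ⊕ (rw a c (suc K) * rw b d (suc K)) ·t F p (suc K)
  F-column p K first zero    = trans first (sym (trans (+-identityʳ _) (+-identityʳ _)))
  F-column p K first (suc n) = genS2′-columns a b c d (double n +ℕ p) K

  rowWeight-double : ∀ x y k → rw x y (double k) ≈ (x * y) ^ k
  rowWeight-double x y zero    = refl
  rowWeight-double x y (suc k) = trans (*-congˡ (*-congˡ (rowWeight-double x y k))) (sym (*-assoc x y _))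

  private
    ^-Q : ∀ x y z w k → x * y * (z * w) ≈ Q → (x * y) ^ k * (z * w) ^ k ≈ Q ^ k
    ^-Q x y z w k xyzw≈Q = trans (sym (^-distrib-* (x * y) (z * w) k)) (^-congˡ k xyzw≈Q)

  column-weight-a : ∀ M → rw a c (suc (double M)) * rw b d (double M) ≈ a * Q ^ M
  column-weight-a M = begin
    (a * rw c a (double M)) * rw b d (double M)
      ≈⟨ *-cong (*-congˡ (rowWeight-double c a M)) (rowWeight-double b d M) ⟩
    (a * (c * a) ^ M) * (b * d) ^ M
      ≈⟨ *-assoc a _ _ ⟩
    a * ((c * a) ^ M * (b * d) ^ M)
      ≈⟨ *-congˡ (^-Q c a b d M (solve 4 (λ a b c d → c :* a :* (b :* d) := a :* b :* c :* d) refl a b c d)) ⟩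
    a * Q ^ M ∎

  column-weight-ab : ∀ M → rw a c (suc (double M)) * rw b d (suc (double M)) ≈ ab * Q ^ M
  column-weight-ab M = begin
    (a * rw c a (double M)) * (b * rw d b (double M))
      ≈⟨ *-cong (*-congˡ (rowWeight-double c a M)) (*-congˡ (rowWeight-double d b M)) ⟩
    (a * (c * a) ^ M) * (b * (d * b) ^ M)
      ≈⟨ solve 4 (λ a b X Y → (a :* X) :* (b :* Y) := (a :* b) :* (X :* Y)) refl a b _ _ ⟩
    ab * ((c * a) ^ M * (d * b) ^ M)
      ≈⟨ *-congˡ (^-Q c a d b M (solve 4 (λ a b c d → c :* a :* (d :* b) := a :* b :* c :* d) refl a b c d)) ⟩
    ab * Q ^ M ∎

  column-weight-abc : ∀ M → rw a c (double (suc M)) * rw b d (suc (double M)) ≈ abc * Q ^ M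
  column-weight-abc M = begin
    rw a c (double (suc M)) * (b * rw d b (double M))
      ≈⟨ *-cong (rowWeight-double a c (suc M)) (*-congˡ (rowWeight-double d b M)) ⟩
    ((a * c) * (a * c) ^ M) * (b * (d * b) ^ M)
      ≈⟨ solve 5 (λ a b c X Y → ((a :* c) :* X) :* (b :* Y) := (a :* b :* c) :* (X :* Y)) refl a b c _ _ ⟩
    abc * ((a * c) ^ M * (d * b) ^ M)
      ≈⟨ *-congˡ (^-Q a c d b M (solve 4 (λ a b c d → a :* c :* (d :* b) := a :* b :* c :* d) refl a b c d)) ⟩
    abc * Q ^ M ∎

  column-weight-Q : ∀ M → rw a c (double (suc M)) * rw b d (double (suc M)) ≈ Q ^ suc M
  column-weight-Q M =
    trans (*-cong (rowWeight-double a c (suc M)) (rowWeight-double b d (suc M)))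
          (^-Q a c b d (suc M) (solve 4 (λ a b c d → a :* c :* (b :* d) := a :* b :* c :* d) refl a b c d))

  evenEven evenOdd oddOdd oddEven : ℕ → Seq
  evenEven M = A a M       ⊛ B ab M       ⊛ A abc M       ⊛ B 1# (suc M)
  evenOdd  M = A a (suc M) ⊛ B ab (suc M) ⊛ A abc M       ⊛ B 1# (suc M)
  oddOdd   M = A₁ M        ⊛ B ab (suc M) ⊛ A abc M       ⊛ B 1# (suc M)
  oddEven  M = A₁ M        ⊛ B ab (suc M) ⊛ A abc (suc M) ⊛ B 1# (suc (suc M))

  evenOdd-step : ∀ M → evenOdd M ≋ evenEven M ⊕ (a * Q ^ M) ·t evenEven M ⊕ (ab * Q ^ M) ·t evenOdd M
  evenOdd-step M = ⊛-ratio (A-suc a M) (⊛-recurrenceʳ (A abc M ⊛ B 1# (suc M)) (B-suc ab M))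

  evenEven-step : ∀ M → evenEven (suc M) ≋ evenOdd M ⊕ (abc * Q ^ M) ·t evenOdd M ⊕ (1# * Q ^ suc M) ·t evenEven (suc M)
  evenEven-step M = ⊛-ratioˡ (A a (suc M)) (⊛-ratioˡ (B ab (suc M)) (⊛-ratio (A-suc abc M) (B-suc 1# (suc M))))

  oddEven-step : ∀ M → oddEven M ≋ oddOdd M ⊕ (abc * Q ^ M) ·t oddOdd M ⊕ (1# * Q ^ suc M) ·t oddEven M
  oddEven-step M = ⊛-ratioˡ (A₁ M) (⊛-ratioˡ (B ab (suc M)) (⊛-ratio (A-suc abc M) (B-suc 1# (suc M))))

  oddOdd-step : ∀ M → oddOdd (suc M) ≋ oddEven M ⊕ ((a * Q) * Q ^ M) ·t oddEven M ⊕ (ab * Q ^ suc M) ·t oddOdd (suc M)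
  oddOdd-step M = ⊛-ratio (A₁-suc M) (⊛-recurrenceʳ (A abc (suc M) ⊛ B 1# (suc (suc M))) (B-suc ab (suc M)))

  private
    ⊛-unitˡ : ∀ X Y → X 0 ≈ 1# → (∀ i → X (suc i) ≈ 0#) → X ⊛ Y ≋ Y
    ⊛-unitˡ X Y X₀≈1 X≈δ n = trans (⊛-δˡ X Y X≈δ n) (trans (*-congʳ X₀≈1) (*-identityˡ _))

    empty-products : A abc 0 ⊛ B 1# 1 ≋ λ _ → 1#
    empty-products n = trans (⊛-unitˡ (A abc 0) (B 1# 1) (A-head abc 0) (A-empty abc) n) (B-ones n)

  evenEven-0 : evenEven 0 ≋ λ _ → 1#
  evenEven-0 n =
    trans (⊛-unitˡ (A a 0) (B ab 0 ⊛ A abc 0 ⊛ B 1# 1) (A-head a 0) (A-empty a) n)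
          (trans (⊛-unitˡ (B ab 0) (A abc 0 ⊛ B 1# 1) (B-head ab 0) (B-empty ab) n) (empty-products n))

  oddOdd-0 : oddOdd 0 ≋ (λ _ → 1# + a) ⊕ (ab * Q ^ 0) ·t oddOdd 0
  oddOdd-0 n = trans (⊛-recurrenceˡ (A₁ 0) (⊛-recurrenceʳ (A abc 0 ⊛ B 1# 1) (B-suc ab 0)) n) (+-congʳ initial)
    where
    initial : (A₁ 0 ⊛ B ab 0 ⊛ A abc 0 ⊛ B 1# 1) n ≈ 1# + a
    initial = trans (⊛-δˡ (A₁ 0) (B ab 0 ⊛ A abc 0 ⊛ B 1# 1) (λ i → trans (*-congˡ (A-empty (a * Q) i)) (zeroʳ _)) n)
                    (trans (*-cong (*-congˡ (A-head (a * Q) 0))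
                                   (trans (⊛-unitˡ (B ab 0) (A abc 0 ⊛ B 1# 1) (B-head ab 0) (B-empty ab) n) (empty-products n)))
                           (trans (*-identityʳ _) (*-identityʳ _)))

  private
    even-first : ∀ K → genS2′ a b c d 0 (suc K) ≈ genS2′ a b c d 0 K
    even-first K = trans (genS2′-0 a b c d (suc K)) (sym (genS2′-0 a b c d K))

    odd-first : ∀ K → genS2′ a b c d 1 (suc (suc K)) ≈ genS2′ a b c d 1 (suc K)
    odd-first K = trans (genS2′-1 a b c d (suc K)) (sym (genS2′-1 a b c d K))

    -- F(1 + 2n, 1) = 1 + a + ab F(2n − 1, 1): the one step where F p K 0 changes with K.
    F-1-1 : F 1 1 ≋ (λ _ → 1# + a) ⊕ (rw a c 1 * rw b d 1) ·t F 1 1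
    F-1-1 zero    = trans (genS2′-1 a b c d 0) (sym (+-identityʳ _))
    F-1-1 (suc n) = trans (genS2′-columns a b c d (double n +ℕ 1) 0)
                          (+-congʳ (+-congˡ (trans (*-identityʳ _) (trans (*-identityʳ _) (*-identityʳ a)))))

    1*Q^M≈ : ∀ M → rw a c (double (suc M)) * rw b d (double (suc M)) ≈ 1# * Q ^ suc M
    1*Q^M≈ M = trans (column-weight-Q M) (sym (*-identityˡ _))

  evenEven-correct : ∀ M → F 0 (double M) ≋ evenEven M
  evenOdd-correct  : ∀ M → F 0 (suc (double M)) ≋ evenOdd M

  evenEven-correct zero    n = sym (evenEven-0 n)
  evenEven-correct (suc M)   = ratio-unique (F-column 0 (suc (double M)) (even-first (suc (double M)))) (evenEven-step M)
                                            (evenOdd-correct M) (column-weight-abc M) (1*Q^M≈ M)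
  evenOdd-correct M = ratio-unique (F-column 0 (double M) (even-first (double M))) (evenOdd-step M)
                                   (evenEven-correct M) (column-weight-a M) (column-weight-ab M)

  oddOdd-correct  : ∀ M → F 1 (suc (double M)) ≋ oddOdd M
  oddEven-correct : ∀ M → F 1 (double (suc M)) ≋ oddEven M

  oddOdd-correct zero    = recurrence-unique F-1-1 oddOdd-0 (λ _ → refl) (column-weight-ab 0)
  oddOdd-correct (suc M) = ratio-unique (F-column 1 (double (suc M)) (odd-first (suc (double M)))) (oddOdd-step M) (oddEven-correct M)
                                        (trans (column-weight-a (suc M)) (sym (*-assoc a Q _))) (column-weight-ab (suc M))
  oddEven-correct M = ratio-unique (F-column 1 (suc (double M)) (odd-first (double M))) (oddEven-step M)
                                   (oddOdd-correct M) (column-weight-abc M) (1*Q^M≈ M)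

  from-product : ∀ {p K N′ K′} N (W X Y Z : Seq) → N′ ≡ double N +ℕ p → K′ ≡ K → F p K ≋ W ⊛ X ⊛ Y ⊛ Z →
                 ∀ f → (∀ m₁ m₂ m₃ m₄ → f m₁ m₂ m₃ m₄ ≈ W m₁ * (X m₂ * (Y m₃ * Z m₄))) →
                 genS2 R a b c d N′ K′ ≈ sum4 R N f
  from-product {p} {K} N W X Y Z ≡.refl ≡.refl F≋ f f≈ =
    trans (genS2≈genS2′ a b c d (double N +ℕ p) K) (trans (F≋ N) (sym (sum4≈⊛ N f W X Y Z f≈)))

  regroup : ∀ {x x′ y₁ y₂ z₁ z₂ z₃ w w′} → x ≈ x′ → w ≈ w′ →
            x * y₁ * y₂ * z₁ * z₂ * z₃ * w ≈ x′ * ((y₁ * y₂) * ((z₁ * z₂ * z₃) * w′))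
  regroup {x} {x′} {y₁} {y₂} {z₁} {z₂} {z₃} {w} {w′} x≈x′ w≈w′ = begin
    x * y₁ * y₂ * z₁ * z₂ * z₃ * w
      ≈⟨ solve 7 (λ x y₁ y₂ z₁ z₂ z₃ w → x :* y₁ :* y₂ :* z₁ :* z₂ :* z₃ :* w
                                         := x :* ((y₁ :* y₂) :* ((z₁ :* z₂ :* z₃) :* w))) refl x y₁ y₂ z₁ z₂ z₃ w ⟩
    x * ((y₁ * y₂) * ((z₁ * z₂ * z₃) * w))
      ≈⟨ *-cong x≈x′ (*-congˡ (*-congˡ w≈w′)) ⟩
    x′ * ((y₁ * y₂) * ((z₁ * z₂ * z₃) * w′)) ∎

  A-term : ∀ M m → gauss R Q (M +ℕ 1) m * a ^ m * Q ^ binom2 m ≈ A a (suc M) m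
  A-term M m = reflexive (≡.cong (λ k → gauss R Q k m * a ^ m * Q ^ binom2 m) (ℕₚ.+-comm M 1))

  A₁-term : ∀ M m → gauss R Q M m * (1# + a) * a ^ m * Q ^ binom2 (m +ℕ 1) ≈ A₁ M m
  A₁-term M m = begin
    G * (1# + a) * a ^ m * Q ^ binom2 (m +ℕ 1)
      ≈⟨ *-congˡ (reflexive (≡.cong (λ k → Q ^ binom2 k) (ℕₚ.+-comm m 1))) ⟩
    G * (1# + a) * a ^ m * Q ^ binom2 (suc m)
      ≈⟨ *-congˡ (^-binom2-suc Q m) ⟩
    G * (1# + a) * a ^ m * (Q ^ binom2 m * Q ^ m)
      ≈⟨ solve 5 (λ G o aᵐ C Qᵐ → G :* o :* aᵐ :* (C :* Qᵐ) := o :* (G :* (aᵐ :* Qᵐ) :* C))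
                 refl G (1# + a) (a ^ m) _ _ ⟩
    (1# + a) * (G * (a ^ m * Q ^ m) * Q ^ binom2 m)
      ≈⟨ *-congˡ (*-congʳ (*-congˡ (sym (^-distrib-* a Q m)))) ⟩
    A₁ M m ∎
    where G = gauss R Q M m

  D-term : ∀ M m → gauss R Q (M +ℕ m) m ≈ B 1# (suc M) m
  D-term M m = sym (trans (*-congˡ (1^n≈1 m)) (*-identityʳ _))

  private
    2*≡ : ∀ n → 2 *ℕ n ≡ double n
    2*≡ n = ≡.sym (double≡2* n)

    2*≡+0 : ∀ n → 2 *ℕ n ≡ double n +ℕ 0
    2*≡+0 n = ≡.trans (2*≡ n) (≡.sym (ℕₚ.+-identityʳ _))

    2*+1≡ : ∀ n → 2 *ℕ n +ℕ 1 ≡ double n +ℕ 1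
    2*+1≡ n = ≡.cong (_+ℕ 1) (2*≡ n)

    2*+1≡suc : ∀ n → 2 *ℕ n +ℕ 1 ≡ suc (double n)
    2*+1≡suc n = ≡.trans (ℕₚ.+-comm _ 1) (≡.cong suc (2*≡ n))

  genS2-even-odd : ∀ N M →
    genS2 R a b c d (2 *ℕ N) (2 *ℕ M +ℕ 1)
      ≈ sum4 R N (λ m₁ m₂ m₃ m₄ →
          gauss R Q (M +ℕ 1) m₁ * a ^ m₁ * Q ^ binom2 m₁
          * gauss R Q (M +ℕ m₂) m₂ * (a * b) ^ m₂
          * gauss R Q M m₃ * (a * b * c) ^ m₃ * Q ^ binom2 m₃
          * gauss R Q (M +ℕ m₄) m₄)
  genS2-even-odd N M = from-product N _ _ _ _ (2*≡+0 N) (2*+1≡suc M) (evenOdd-correct M) _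
                         (λ m₁ _ _ m₄ → regroup (A-term M m₁) (D-term M m₄))

  genS2-odd-odd : ∀ N M →
    genS2 R a b c d (2 *ℕ N +ℕ 1) (2 *ℕ M +ℕ 1)
      ≈ sum4 R N (λ m₁ m₂ m₃ m₄ →
          gauss R Q M m₁ * (1# + a) * a ^ m₁ * Q ^ binom2 (m₁ +ℕ 1)
          * gauss R Q (M +ℕ m₂) m₂ * (a * b) ^ m₂
          * gauss R Q M m₃ * (a * b * c) ^ m₃ * Q ^ binom2 m₃
          * gauss R Q (M +ℕ m₄) m₄)
  genS2-odd-odd N M = from-product N _ _ _ _ (2*+1≡ N) (2*+1≡suc M) (oddOdd-correct M) _
                        (λ m₁ _ _ m₄ → regroup (A₁-term M m₁) (D-term M m₄))

  genS2-even-even : ∀ N M → 1 ≤ M →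
    genS2 R a b c d (2 *ℕ N) (2 *ℕ M)
      ≈ sum4 R N (λ m₁ m₂ m₃ m₄ →
          gauss R Q M m₁ * a ^ m₁ * Q ^ binom2 m₁
          * gauss R Q (M +ℕ m₂ ∸ 1) m₂ * (a * b) ^ m₂
          * gauss R Q M m₃ * (a * b * c) ^ m₃ * Q ^ binom2 m₃
          * gauss R Q (M +ℕ m₄) m₄)
  genS2-even-even N (suc M) _ = from-product N _ _ _ _ (2*≡+0 N) (2*≡ (suc M)) (evenEven-correct (suc M)) _
                                  (λ _ _ _ m₄ → regroup refl (D-term (suc M) m₄))

  genS2-odd-even : ∀ N M → 1 ≤ M →
    genS2 R a b c d (2 *ℕ N +ℕ 1) (2 *ℕ M)
      ≈ sum4 R N (λ m₁ m₂ m₃ m₄ →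
          gauss R Q (M ∸ 1) m₁ * (1# + a) * a ^ m₁ * Q ^ binom2 (m₁ +ℕ 1)
          * gauss R Q (M +ℕ m₂ ∸ 1) m₂ * (a * b) ^ m₂
          * gauss R Q M m₃ * (a * b * c) ^ m₃ * Q ^ binom2 m₃
          * gauss R Q (M +ℕ m₄) m₄)
  genS2-odd-even N (suc M) _ = from-product N _ _ _ _ (2*+1≡ N) (2*≡ (suc M)) (oddEven-correct M) _
                                 (λ m₁ _ _ m₄ → regroup (A₁-term M m₁) (D-term (suc M) m₄))

theorem4p6 : {ℓ₁ ℓ₂ : Level} (R : CommutativeRing ℓ₁ ℓ₂) →
    let open CommutativeRing R
        Qb = gauss R
        _^_ = pow R
    in (a b c d : Carrier) (N M : ℕ) →
    let Q = a * b * c * d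
    in (genS2 R a b c d (2 *ℕ N) (2 *ℕ M +ℕ 1)
          ≈ sum4 R N (λ m₁ m₂ m₃ m₄ →
              Qb Q (M +ℕ 1) m₁ * (a ^ m₁) * (Q ^ binom2 m₁)
              * Qb Q (M +ℕ m₂) m₂ * ((a * b) ^ m₂)
              * Qb Q M m₃ * ((a * b * c) ^ m₃) * (Q ^ binom2 m₃)
              * Qb Q (M +ℕ m₄) m₄))
     × (genS2 R a b c d (2 *ℕ N +ℕ 1) (2 *ℕ M +ℕ 1)
          ≈ sum4 R N (λ m₁ m₂ m₃ m₄ →
              Qb Q M m₁ * (1# + a) * (a ^ m₁) * (Q ^ binom2 (m₁ +ℕ 1))
              * Qb Q (M +ℕ m₂) m₂ * ((a * b) ^ m₂)
              * Qb Q M m₃ * ((a * b * c) ^ m₃) * (Q ^ binom2 m₃)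
              * Qb Q (M +ℕ m₄) m₄))
     × (1 ≤ M →
         genS2 R a b c d (2 *ℕ N) (2 *ℕ M)
          ≈ sum4 R N (λ m₁ m₂ m₃ m₄ →
              Qb Q M m₁ * (a ^ m₁) * (Q ^ binom2 m₁)
              * Qb Q (M +ℕ m₂ ∸ 1) m₂ * ((a * b) ^ m₂)
              * Qb Q M m₃ * ((a * b * c) ^ m₃) * (Q ^ binom2 m₃)
              * Qb Q (M +ℕ m₄) m₄))
     × (1 ≤ M →
         genS2 R a b c d (2 *ℕ N +ℕ 1) (2 *ℕ M)
          ≈ sum4 R N (λ m₁ m₂ m₃ m₄ →
              Qb Q (M ∸ 1) m₁ * (1# + a) * (a ^ m₁) * (Q ^ binom2 (m₁ +ℕ 1))
              * Qb Q (M +ℕ m₂ ∸ 1) m₂ * ((a * b) ^ m₂)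
              * Qb Q M m₃ * ((a * b * c) ^ m₃) * (Q ^ binom2 m₃)
              * Qb Q (M +ℕ m₄) m₄))
theorem4p6 R a b c d N M =
  genS2-even-odd N M , genS2-odd-odd N M , genS2-even-even N M , genS2-odd-even N M
  where open ProductFormula R a b c d
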